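{- Let $W\subseteq V(G)$ with $|W|\ge 8\nabla_1/\alpha^2$. Then there are at most $4\nabla_1/\alpha$ vertices of $G$ that are $\alpha$-strong for $W$.
   Context: Graphs are finite, simple, undirected. $N[v]$ is the closed neighborhood of $v$. $\nabla_1(G)$ is the maximum of $|E(H)|/|V(H)|$ over all $1$-shallow minors $H$ of $G$ (graphs obtained from pairwise vertex-disjoint connected subgraphs of $G$ of radius at most $1$ as branch sets, two vertices adjacent when some edge of $G$ joins their branch sets). Standing assumptions: $G$ is a fixed graph such that for every $v\in V(G)$, $N(v)$ can be dominated by at most $2\nabla_1(G)$ vertices different from $v$; $\nabla_1=\nabla_1(G)$, $k=2\nabla_1$, $\alpha=1/k$. A vertex $z$ is $\alpha$-strong for $W$ if $|N[z]\cap W|\ge\alpha|W|$. -}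

module Defs where

open import Data.Nat as ℕ using (ℕ; suc)
open import Data.Bool using (Bool; true; false; _∧_; _∨_; if_then_else_)
open import Data.Fin using (Fin; _≟_; _<?_)
open import Data.Fin.Subset using (Subset; _∈_; _∉_; ∣_∣; _∩_)
open import Data.Vec using (Vec; tabulate; lookup)
import Data.Vec as Vec
open import Data.Integer using (+_)
open import Data.Rational using (ℚ; _/_; _*_; _+_; _÷_; 1/_; _≤_; _<_; 0ℚ; Positive)
open import Data.Rational.Properties using (pos⇒nonZero; pos+pos⇒pos; pos*pos⇒pos; 1/pos⇒pos)
open import Data.Product using (Σ; ∃; _×_; _,_)
open import Data.Sum using (_⊎_)
open import Relation.Nullary.Decidable using (isYes)
open import Relation.Binary.PropositionalEquality using (_≡_)

record Graph (n : ℕ) : Set where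
  field
    adj    : Fin n → Fin n → Bool
    sym    : ∀ u v → adj u v ≡ adj v u
    irrefl : ∀ v → adj v v ≡ false
open Graph public

ℕ→ℚ : ℕ → ℚ
ℕ→ℚ m = + m / 1

anyFin : ∀ {n} → (Fin n → Bool) → Bool
anyFin f = Vec.foldr _ _∨_ false (tabulate f)

N : ∀ {n} → Graph n → Fin n → Subset n
N G v = tabulate (adj G v)

N[_] : ∀ {n} → Graph n → Fin n → Subset n
N[ G ] v = tabulate (λ u → isYes (u ≟ v) ∨ adj G v u)

Dominates : ∀ {n} → Graph n → Subset n → Subset n → Set
Dominates {n} G D X =
  ∀ u → u ∈ X → u ∈ D ⊎ Σ (Fin n) (λ d → d ∈ D × adj G d u ≡ true)

-- A 1-shallow minor with m vertices: m pairwise disjoint branch sets, each of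
-- radius ≤ 1 in G (i.e. it has a centre adjacent to all its other vertices;
-- in particular it is nonempty and connected).
record ShallowMinor1 {n : ℕ} (G : Graph n) (m : ℕ) : Set where
  field
    branch   : Fin m → Subset n
    centre   : Fin m → Fin n
    centre∈  : ∀ i → centre i ∈ branch i
    radius≤1 : ∀ i b → b ∈ branch i → b ≡ centre i ⊎ adj G (centre i) b ≡ true
    disjoint : ∀ i j b → b ∈ branch i → b ∈ branch j → i ≡ j
open ShallowMinor1 public

linked : ∀ {n m} {G : Graph n} → ShallowMinor1 G m → Fin m → Fin m → Bool
linked {G = G} M i j =
  anyFin (λ b → anyFin (λ b′ → lookup (branch M i) b ∧ lookup (branch M j) b′ ∧ adj G b b′))

edges : ∀ {n m} {G : Graph n} → ShallowMinor1 G m → ℕ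
edges {m = m} M = Vec.sum (tabulate (λ i → ∣ tabulate (λ j → isYes (i <? j) ∧ linked M i j) ∣))

-- d = ∇₁(G): the maximum of |E(H)|/|V(H)| over (nonempty) 1-shallow minors H of G
IsNabla1 : ∀ {n} → Graph n → ℚ → Set
IsNabla1 G d =
  (∀ m (M : ShallowMinor1 G (suc m)) → (+ edges M / suc m) ≤ d)
  × Σ ℕ (λ m → Σ (ShallowMinor1 G (suc m)) (λ M → (+ edges M / suc m) ≡ d))

kOf : ℚ → ℚ
kOf d = d + d

αOf : (d : ℚ) → 0ℚ < d → ℚ
αOf d p = (1/ (d + d)) {{pos⇒nonZero (d + d) {{pos+pos⇒pos d {{Data.Rational.positive p}} d {{Data.Rational.positive p}}}}}}

αOf-pos : (d : ℚ) (p : 0ℚ < d) → Positive (αOf d p)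
αOf-pos d p = 1/pos⇒pos (d + d) {{pos+pos⇒pos d {{Data.Rational.positive p}} d {{Data.Rational.positive p}}}}

threshold : (d : ℚ) → 0ℚ < d → ℚ
threshold d p = ((+ 8 / 1) * d ÷ (αOf d p * αOf d p))
  {{pos⇒nonZero (αOf d p * αOf d p) {{pos*pos⇒pos (αOf d p) {{αOf-pos d p}} (αOf d p) {{αOf-pos d p}}}}}}

bound : (d : ℚ) → 0ℚ < d → ℚ
bound d p = ((+ 4 / 1) * d ÷ αOf d p) {{pos⇒nonZero (αOf d p) {{αOf-pos d p}}}}

StandingAssumption : ∀ {n} → Graph n → ℚ → Set
StandingAssumption {n} G k =
  ∀ v → Σ (Subset n) (λ D → v ∉ D × ℕ→ℚ ∣ D ∣ ≤ k × Dominates G D (N G v))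

IsStrong : ∀ {n} → Graph n → ℚ → Subset n → Fin n → Set
IsStrong G a W z = a * ℕ→ℚ ∣ W ∣ ≤ ℕ→ℚ ∣ N[ G ] z ∩ W ∣

-- With singleton branch sets, the subgraph induced by U = S ∪ W is a 1-shallow minor of G, so
-- it has e ≤ ∇₁|U| ≤ ∇₁(|S| + |W|) edges.  Since N[z] ∩ W ⊆ {z} ∪ (N(z) ∩ U), summing over the
-- strong vertices z ∈ S counts every edge of G[U] at most twice:
-- |S| · α|W| ≤ Σ_{z ∈ S} |N[z] ∩ W| ≤ |S| + 2e, that is |S||W| ≤ k(|S| + k(|S| + |W|)).
-- As ∇₁ > 0, G has an edge, and a single edge is a minor of density 1/2, so k ≥ 1; then
-- |W| ≥ 8∇₁/α² = 4k³ forces |S| ≤ 2k² = 4∇₁/α.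

module Submission where

open import Defs
open import Data.Nat using (ℕ)
open import Data.Fin.Subset using (Subset; _∈_; ∣_∣; _∩_; _∪_)

module Counting where

  import Algebra.Properties.CommutativeMonoid.Sum as Sum
  import Algebra.Properties.CommutativeSemigroup as CommSemigroup
  open import Data.Bool using (Bool; true; false; _∧_; _∨_; if_then_else_)
  import Data.Bool as Bool
  open import Data.Bool.Properties using (∨-identityʳ; ∧-zeroʳ)
  open import Data.Empty using (⊥-elim)
  open import Data.Fin using (Fin; zero; suc; _≟_; _<?_)
  open import Data.Fin.Properties using (suc-injective; <-asym; <-cmp; any?)
  open import Data.Fin.Subset using (_⊆_; ⁅_⁆)
  open import Data.Fin.Subset.Properties using (x∈⁅x⁆; x∈⁅y⁆⇒x≡y; ∣⁅x⁆∣≡1; x∈p∩q⁻; x∈p∩q⁺; x∈p∪q⁺; p⊆p∪q; q⊆p∪q; p⊆q⇒∣p∣≤∣q∣; drop-∷-⊆)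
  open import Data.Nat using (zero; suc; _+_; _≤_; z≤n; s≤s)
  open import Data.Nat.Properties using (+-0-commutativeMonoid; +-commutativeSemigroup; +-identityʳ; +-suc; +-mono-≤; +-monoʳ-≤; m≤n⇒m≤o+n; n≤1+n; ≤-trans; module ≤-Reasoning)
  open import Data.Product using (Σ; ∃₂; _,_)
  open import Data.Sum using (inj₁; inj₂)
  open import Data.Vec using ([]; _∷_; here; there; tabulate; lookup; replicate)
  import Data.Vec as Vec
  open import Data.Vec.Properties using (lookup-replicate; lookup∘tabulate; []=⇒lookup; lookup⇒[]=)
  open import Function.Base using (_∘_)
  open import Function.Definitions using (Injective)
  open import Relation.Binary.Definitions using (tri<; tri≈; tri>)
  open import Relation.Binary.PropositionalEquality using (_≡_; _≢_; refl; cong; cong₂; subst; trans; module ≡-Reasoning)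
  import Relation.Binary.PropositionalEquality as ≡
  open import Relation.Nullary using (Dec; yes; no)
  open import Relation.Nullary.Decidable using (isYes)

  open Sum +-0-commutativeMonoid public using (sum)
  open Sum +-0-commutativeMonoid using (sum-cong-≗; sum-replicate-zero; ∑-distrib-+; ∑-comm)
  open CommSemigroup +-commutativeSemigroup using (x∙yz≈y∙xz)

  𝟙 : Bool → ℕ
  𝟙 b = if b then 1 else 0

  infixl 7 _⇂_
  _⇂_ : ∀ {n} → (Fin n → ℕ) → Subset n → Fin n → ℕ
  (f ⇂ p) u = if lookup p u then f u else 0

  ∣tabulate∣≡∑ : ∀ {n} (f : Fin n → Bool) → ∣ tabulate f ∣ ≡ sum (𝟙 ∘ f)
  ∣tabulate∣≡∑ {zero}  f = refl
  ∣tabulate∣≡∑ {suc n} f with f zero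
  ... | true  = cong suc (∣tabulate∣≡∑ (f ∘ suc))
  ... | false = ∣tabulate∣≡∑ (f ∘ suc)

  ∣tabulate∩p∣≡∑ : ∀ {n} (f : Fin n → Bool) (p : Subset n) → ∣ tabulate f ∩ p ∣ ≡ sum ((𝟙 ∘ f) ⇂ p)
  ∣tabulate∩p∣≡∑ f []          = refl
  ∣tabulate∩p∣≡∑ f (true ∷ p)  with f zero
  ... | true  = cong suc (∣tabulate∩p∣≡∑ (f ∘ suc) p)
  ... | false = ∣tabulate∩p∣≡∑ (f ∘ suc) p
  ∣tabulate∩p∣≡∑ f (false ∷ p) with f zero
  ... | true  = ∣tabulate∩p∣≡∑ (f ∘ suc) p
  ... | false = ∣tabulate∩p∣≡∑ (f ∘ suc) p

  ∣p∪q∣≤∣p∣+∣q∣ : ∀ {n} (p q : Subset n) → ∣ p ∪ q ∣ ≤ ∣ p ∣ + ∣ q ∣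
  ∣p∪q∣≤∣p∣+∣q∣ []          []          = z≤n
  ∣p∪q∣≤∣p∣+∣q∣ (true ∷ p)  (true ∷ q)  = s≤s (≤-trans (∣p∪q∣≤∣p∣+∣q∣ p q) (+-monoʳ-≤ ∣ p ∣ (n≤1+n ∣ q ∣)))
  ∣p∪q∣≤∣p∣+∣q∣ (true ∷ p)  (false ∷ q) = s≤s (∣p∪q∣≤∣p∣+∣q∣ p q)
  ∣p∪q∣≤∣p∣+∣q∣ (false ∷ p) (true ∷ q)  = subst (suc ∣ p ∪ q ∣ ≤_) (≡.sym (+-suc ∣ p ∣ ∣ q ∣)) (s≤s (∣p∪q∣≤∣p∣+∣q∣ p q))
  ∣p∪q∣≤∣p∣+∣q∣ (false ∷ p) (false ∷ q) = ∣p∪q∣≤∣p∣+∣q∣ p q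

  ∑-⇂-mono : ∀ {n} (p : Subset n) (f g : Fin n → ℕ) → (∀ {u} → u ∈ p → f u ≤ g u) → sum (f ⇂ p) ≤ sum (g ⇂ p)
  ∑-⇂-mono []          f g f≤g = z≤n
  ∑-⇂-mono (true ∷ p)  f g f≤g = +-mono-≤ (f≤g here) (∑-⇂-mono p (f ∘ suc) (g ∘ suc) (f≤g ∘ there))
  ∑-⇂-mono (false ∷ p) f g f≤g = ∑-⇂-mono p (f ∘ suc) (g ∘ suc) (f≤g ∘ there)

  ∑-⇂-mono-⊆ : ∀ {n} {p q : Subset n} (f : Fin n → ℕ) → p ⊆ q → sum (f ⇂ p) ≤ sum (f ⇂ q)
  ∑-⇂-mono-⊆ {p = []}        {[]}        f p⊆q = z≤n
  ∑-⇂-mono-⊆ {p = true ∷ p}  {true ∷ q}  f p⊆q = +-monoʳ-≤ (f zero) (∑-⇂-mono-⊆ (f ∘ suc) (drop-∷-⊆ p⊆q))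
  ∑-⇂-mono-⊆ {p = true ∷ p}  {false ∷ q} f p⊆q with () ← p⊆q here
  ∑-⇂-mono-⊆ {p = false ∷ p} {true ∷ q}  f p⊆q = m≤n⇒m≤o+n (f zero) (∑-⇂-mono-⊆ (f ∘ suc) (drop-∷-⊆ p⊆q))
  ∑-⇂-mono-⊆ {p = false ∷ p} {false ∷ q} f p⊆q = ∑-⇂-mono-⊆ (f ∘ suc) (drop-∷-⊆ p⊆q)

  ∑-suc-⇂ : ∀ {n} (p : Subset n) (f : Fin n → ℕ) → sum ((suc ∘ f) ⇂ p) ≡ ∣ p ∣ + sum (f ⇂ p)
  ∑-suc-⇂ []          f = refl
  ∑-suc-⇂ (true ∷ p)  f = cong suc (trans (cong (f zero +_) (∑-suc-⇂ p (f ∘ suc))) (x∙yz≈y∙xz (f zero) ∣ p ∣ _))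
  ∑-suc-⇂ (false ∷ p) f = ∑-suc-⇂ p (f ∘ suc)

  enumerate : ∀ {n} (p : Subset n) → Fin ∣ p ∣ → Fin n
  enumerate (true ∷ p)  zero    = zero
  enumerate (true ∷ p)  (suc i) = suc (enumerate p i)
  enumerate (false ∷ p) i       = suc (enumerate p i)

  enumerate-injective : ∀ {n} (p : Subset n) → Injective _≡_ _≡_ (enumerate p)
  enumerate-injective (true ∷ p)  {zero}  {zero}  _  = refl
  enumerate-injective (true ∷ p)  {suc i} {suc j} eq = cong suc (enumerate-injective p (suc-injective eq))
  enumerate-injective (false ∷ p)                 eq = enumerate-injective p (suc-injective eq)

  ∑-enumerate : ∀ {n} (p : Subset n) (f : Fin n → ℕ) → sum (f ∘ enumerate p) ≡ sum (f ⇂ p)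
  ∑-enumerate []          f = refl
  ∑-enumerate (true ∷ p)  f = cong (f zero +_) (∑-enumerate p (f ∘ suc))
  ∑-enumerate (false ∷ p) f = ∑-enumerate p (f ∘ suc)

  anyFin-cong : ∀ {n} {f g : Fin n → Bool} → (∀ b → f b ≡ g b) → anyFin f ≡ anyFin g
  anyFin-cong {zero}  f≗g = refl
  anyFin-cong {suc n} f≗g = cong₂ _∨_ (f≗g zero) (anyFin-cong (f≗g ∘ suc))

  anyFin-false : ∀ {n} {f : Fin n → Bool} → (∀ b → f b ≡ false) → anyFin f ≡ false
  anyFin-false {zero}          f≡false = refl
  anyFin-false {suc n} {f = f} f≡false =
    trans (cong (_∨ anyFin (f ∘ suc)) (f≡false zero)) (anyFin-false (f≡false ∘ suc))

  anyFin-∧ˡ : ∀ {n} c (f : Fin n → Bool) → anyFin (λ b → c ∧ f b) ≡ c ∧ anyFin f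
  anyFin-∧ˡ true  f = refl
  anyFin-∧ˡ false f = anyFin-false {f = λ b → false ∧ f b} (λ _ → refl)

  anyFin-⁅⁆ : ∀ {n} (x : Fin n) (f : Fin n → Bool) → anyFin (λ b → lookup ⁅ x ⁆ b ∧ f b) ≡ f x
  anyFin-⁅⁆ zero    f = trans (cong (f zero ∨_) (anyFin-false off-x)) (∨-identityʳ (f zero))
    where
    off-x : ∀ b → lookup (replicate _ false) b ∧ f (suc b) ≡ false
    off-x b = cong (_∧ f (suc b)) (lookup-replicate b false)
  anyFin-⁅⁆ (suc x) f = anyFin-⁅⁆ x (f ∘ suc)

  ascendingPairs : ∀ {m} → (Fin m → Fin m → Bool) → ℕ
  ascendingPairs a = sum (λ i → sum (λ j → 𝟙 (isYes (i <? j) ∧ a i j)))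

  sum-tabulate : ∀ {n} (f : Fin n → ℕ) → Vec.sum (tabulate f) ≡ sum f
  sum-tabulate {zero}  f = refl
  sum-tabulate {suc n} f = cong (f zero +_) (sum-tabulate (f ∘ suc))

  handshake : ∀ {m} (a : Fin m → Fin m → Bool) → (∀ i j → a i j ≡ a j i) → (∀ i → a i i ≡ false) →
              sum (λ i → sum (λ j → 𝟙 (a i j))) ≡ ascendingPairs a + ascendingPairs a
  handshake {m} a a-sym a-irrefl = begin
    sum (λ i → sum (λ j → 𝟙 (a i j)))                          ≡⟨ sum-cong-≗ (λ i → sum-cong-≗ (split i)) ⟩
    sum (λ i → sum (λ j → ascending i j + ascending j i))      ≡⟨ sum-cong-≗ (λ i → ∑-distrib-+ (ascending i) (λ j → ascending j i)) ⟩
    sum (λ i → sum (ascending i) + sum (λ j → ascending j i))  ≡⟨ ∑-distrib-+ (λ i → sum (ascending i)) _ ⟩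
    ascendingPairs a + sum (λ i → sum (λ j → ascending j i))   ≡⟨ cong (ascendingPairs a +_) (∑-comm (λ i j → ascending j i)) ⟩
    ascendingPairs a + ascendingPairs a                        ∎
    where
    open ≡-Reasoning
    ascending : Fin m → Fin m → ℕ
    ascending i j = 𝟙 (isYes (i <? j) ∧ a i j)
    split : ∀ i j → 𝟙 (a i j) ≡ ascending i j + ascending j i
    split i j with i <? j | j <? i
    ... | yes i<j | yes j<i = ⊥-elim (<-asym i<j j<i)
    ... | yes _   | no _    = ≡.sym (+-identityʳ _)
    ... | no _    | yes _   = cong 𝟙 (a-sym i j)
    ... | no i≮j  | no j≮i  with <-cmp i j
    ...   | tri< i<j _ _ = ⊥-elim (i≮j i<j)
    ...   | tri> _ _ j<i = ⊥-elim (j≮i j<i)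
    ...   | tri≈ _ refl _ = cong 𝟙 (a-irrefl i)

  module _ {n} (G : Graph n) where

    inducedMinor : ∀ {m} (v : Fin m → Fin n) → Injective _≡_ _≡_ v → ShallowMinor1 G m
    inducedMinor v v-inj = record
      { branch   = λ i → ⁅ v i ⁆
      ; centre   = v
      ; centre∈  = λ i → x∈⁅x⁆ (v i)
      ; radius≤1 = λ i b b∈ → inj₁ (x∈⁅y⁆⇒x≡y (v i) b∈)
      ; disjoint = λ i j b b∈i b∈j → v-inj (trans (≡.sym (x∈⁅y⁆⇒x≡y (v i) b∈i)) (x∈⁅y⁆⇒x≡y (v j) b∈j))
      }

    module _ {m} (v : Fin m → Fin n) (v-inj : Injective _≡_ _≡_ v) where

      linked-inducedMinor : ∀ i j → linked (inducedMinor v v-inj) i j ≡ adj G (v i) (v j)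
      linked-inducedMinor i j = begin
        anyFin (λ b → anyFin (λ b′ → lookup ⁅ v i ⁆ b ∧ lookup ⁅ v j ⁆ b′ ∧ adj G b b′))
          ≡⟨ anyFin-cong (λ b → anyFin-∧ˡ (lookup ⁅ v i ⁆ b) (λ b′ → lookup ⁅ v j ⁆ b′ ∧ adj G b b′)) ⟩
        anyFin (λ b → lookup ⁅ v i ⁆ b ∧ anyFin (λ b′ → lookup ⁅ v j ⁆ b′ ∧ adj G b b′))
          ≡⟨ anyFin-⁅⁆ (v i) (λ b → anyFin (λ b′ → lookup ⁅ v j ⁆ b′ ∧ adj G b b′)) ⟩
        anyFin (λ b′ → lookup ⁅ v j ⁆ b′ ∧ adj G (v i) b′)
          ≡⟨ anyFin-⁅⁆ (v j) (adj G (v i)) ⟩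
        adj G (v i) (v j) ∎
        where open ≡-Reasoning

      edges-inducedMinor : edges (inducedMinor v v-inj) ≡ ascendingPairs (λ i j → adj G (v i) (v j))
      edges-inducedMinor = trans (sum-tabulate (λ i → ∣ tabulate (linked< i) ∣)) (sum-cong-≗ λ i →
        trans (∣tabulate∣≡∑ (linked< i)) (sum-cong-≗ λ j → cong (λ l → 𝟙 (isYes (i <? j) ∧ l)) (linked-inducedMinor i j)))
        where
        linked< : Fin m → Fin m → Bool
        linked< i j = isYes (i <? j) ∧ linked (inducedMinor v v-inj) i j

    induced : (U : Subset n) → ShallowMinor1 G ∣ U ∣
    induced U = inducedMinor (enumerate U) (enumerate-injective U)

    deg : Subset n → Fin n → ℕ
    deg U x = ∣ N G x ∩ U ∣

    ∑-deg≡edges+edges : ∀ U → sum (deg U ⇂ U) ≡ edges (induced U) + edges (induced U)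
    ∑-deg≡edges+edges U = begin
      sum (deg U ⇂ U)                                 ≡⟨ ≡.sym (∑-enumerate U (deg U)) ⟩
      sum (deg U ∘ v)                                 ≡⟨ sum-cong-≗ (λ i → trans (∣tabulate∩p∣≡∑ (adj G (v i)) U) (≡.sym (∑-enumerate U _))) ⟩
      sum (λ i → sum (λ j → 𝟙 (adj G (v i) (v j))))  ≡⟨ handshake _ (λ i j → Graph.sym G (v i) (v j)) (irrefl G ∘ v) ⟩
      ascendingPairs a + ascendingPairs a                           ≡⟨ ≡.sym (cong₂ _+_ e≡ e≡) ⟩
      edges (induced U) + edges (induced U)           ∎
      where
      open ≡-Reasoning
      v : Fin ∣ U ∣ → Fin n
      v = enumerate U
      a : Fin ∣ U ∣ → Fin ∣ U ∣ → Bool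
      a i j = adj G (v i) (v j)
      e≡ : edges (induced U) ≡ ascendingPairs a
      e≡ = edges-inducedMinor v (enumerate-injective U)

    N[z]∩W⊆⁅z⁆∪Nz∩U : ∀ {U W} z → W ⊆ U → N[ G ] z ∩ W ⊆ ⁅ z ⁆ ∪ (N G z ∩ U)
    N[z]∩W⊆⁅z⁆∪Nz∩U {U} {W} z W⊆U {u} u∈ with x∈p∩q⁻ (N[ G ] z) W u∈
    ... | u∈N[z] , u∈W with u ≟ z | trans (≡.sym (lookup∘tabulate _ u)) ([]=⇒lookup u∈N[z])
    ...   | yes refl | _        = x∈p∪q⁺ (inj₁ (x∈⁅x⁆ z))
    ...   | no _     | z-adj-u = x∈p∪q⁺ (inj₂ (x∈p∩q⁺ (lookup⇒[]= u (N G z) (trans (lookup∘tabulate _ u) z-adj-u) , W⊆U u∈W)))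

    ∣N[z]∩W∣≤1+deg : ∀ {U W} z → W ⊆ U → ∣ N[ G ] z ∩ W ∣ ≤ suc (deg U z)
    ∣N[z]∩W∣≤1+deg {U} {W} z W⊆U = begin
      ∣ N[ G ] z ∩ W ∣             ≤⟨ p⊆q⇒∣p∣≤∣q∣ (N[z]∩W⊆⁅z⁆∪Nz∩U z W⊆U) ⟩
      ∣ ⁅ z ⁆ ∪ (N G z ∩ U) ∣      ≤⟨ ∣p∪q∣≤∣p∣+∣q∣ ⁅ z ⁆ (N G z ∩ U) ⟩
      ∣ ⁅ z ⁆ ∣ + deg U z          ≡⟨ cong (_+ deg U z) (∣⁅x⁆∣≡1 z) ⟩
      suc (deg U z)                ∎
      where open ≤-Reasoning

    ∑∣N[z]∩W∣≤∣S∣+2e : ∀ S W → sum ((λ z → ∣ N[ G ] z ∩ W ∣) ⇂ S) ≤ ∣ S ∣ + (edges (induced (S ∪ W)) + edges (induced (S ∪ W)))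
    ∑∣N[z]∩W∣≤∣S∣+2e S W = begin
      sum ((λ z → ∣ N[ G ] z ∩ W ∣) ⇂ S)  ≤⟨ ∑-⇂-mono S _ _ (λ {z} _ → ∣N[z]∩W∣≤1+deg z (q⊆p∪q S W)) ⟩
      sum ((suc ∘ deg U) ⇂ S)             ≡⟨ ∑-suc-⇂ S (deg U) ⟩
      ∣ S ∣ + sum (deg U ⇂ S)             ≤⟨ +-monoʳ-≤ ∣ S ∣ (∑-⇂-mono-⊆ (deg U) (p⊆p∪q {p = S} W)) ⟩
      ∣ S ∣ + sum (deg U ⇂ U)             ≡⟨ cong (∣ S ∣ +_) (∑-deg≡edges+edges U) ⟩
      ∣ S ∣ + (edges (induced U) + edges (induced U)) ∎
      where
      open ≤-Reasoning
      U : Subset n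
      U = S ∪ W

    edgeless⇒edges≡0 : (∀ b b′ → adj G b b′ ≡ false) → ∀ {m} (M : ShallowMinor1 G m) → edges M ≡ 0
    edgeless⇒edges≡0 edgeless {m} M = begin
      edges M                                         ≡⟨ sum-tabulate (λ i → ∣ tabulate (linked< i) ∣) ⟩
      sum {m} (λ i → ∣ tabulate (linked< i) ∣)        ≡⟨ sum-cong-≗ (λ i → trans (∣tabulate∣≡∑ (linked< i)) (sum-cong-≗ (cong 𝟙 ∘ unlinked i))) ⟩
      sum {m} (λ _ → sum {m} (λ _ → 0))               ≡⟨ sum-cong-≗ {m} (λ _ → sum-replicate-zero m) ⟩
      sum {m} (λ _ → 0)                               ≡⟨ sum-replicate-zero m ⟩
      0                                               ∎
      where
      open ≡-Reasoning
      linked< : Fin m → Fin m → Bool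
      linked< i j = isYes (i <? j) ∧ linked M i j
      unlinked : ∀ i j → linked< i j ≡ false
      unlinked i j = trans (cong (isYes (i <? j) ∧_) (anyFin-false λ b → anyFin-false λ b′ →
                       trans (cong (λ x → lookup (branch M i) b ∧ lookup (branch M j) b′ ∧ x) (edgeless b b′))
                       (trans (cong (lookup (branch M i) b ∧_) (∧-zeroʳ _)) (∧-zeroʳ _))))
                       (∧-zeroʳ (isYes (i <? j)))

    edge? : Dec (∃₂ λ b b′ → adj G b b′ ≡ true)
    edge? = any? (λ b → any? (λ b′ → adj G b b′ Bool.≟ true))

    edge⇒2-vertex-minor : ∀ {b b′} → adj G b b′ ≡ true → Σ (ShallowMinor1 G 2) (λ M → edges M ≡ 1)
    edge⇒2-vertex-minor {b} {b′} bb′ = inducedMinor v v-inj , trans (edges-inducedMinor v v-inj) one-pair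
      where
      v : Fin 2 → Fin n
      v zero = b
      v (suc zero) = b′
      b≢b′ : b ≢ b′
      b≢b′ refl with () ← trans (≡.sym (irrefl G b)) bb′
      v-inj : Injective _≡_ _≡_ v
      v-inj {zero} {zero} _ = refl
      v-inj {zero} {suc zero} eq = ⊥-elim (b≢b′ eq)
      v-inj {suc zero} {zero} eq = ⊥-elim (b≢b′ (≡.sym eq))
      v-inj {suc zero} {suc zero} _ = refl
      one-pair : ascendingPairs (λ i j → adj G (v i) (v j)) ≡ 1
      one-pair rewrite bb′ = refl

open Counting

import Data.Integer as ℤ
import Data.Integer.Properties as ℤ
import Data.Integer.Solver as ℤ-Solver
import Data.Nat as ℕ
open import Data.Bool using (true; false)
open import Data.Bool.Properties using (¬-not)
open import Data.Empty using (⊥-elim)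
open import Data.Fin using (Fin; zero; suc)
open import Data.Nat using (zero; suc)
open import Data.Product using (∃₂; _,_; proj₁; proj₂)
open import Data.Rational using (ℚ; _≤_; _<_; 0ℚ; 1ℚ; _+_; _*_; _-_; -_; 1/_; _/_; toℚᵘ; Positive; NonNegative; NonZero; positive; nonNegative)
open import Data.Rational.Properties
import Data.Rational.Unnormalised as ℚᵘ
import Data.Rational.Unnormalised.Properties as ℚᵘ
open import Data.Rational.Solver using (module +-*-Solver)
open import Data.Vec using ([]; _∷_; here; there)
open import Function.Base using (_∘_)
open import Relation.Binary.PropositionalEquality using (_≡_; refl; cong; cong₂; subst; subst₂; trans; module ≡-Reasoning)
import Relation.Binary.PropositionalEquality as ≡
open import Relation.Nullary using (Dec; yes; no)

ℕ→ℚ≃ : ∀ m → toℚᵘ (ℕ→ℚ m) ℚᵘ.≃ ℚᵘ.mkℚᵘ (ℤ.+ m) 0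
ℕ→ℚ≃ m = toℚᵘ-fromℚᵘ (ℚᵘ.mkℚᵘ (ℤ.+ m) 0)

ℕ→ℚ-homo-+ : ∀ m n → ℕ→ℚ (m ℕ.+ n) ≡ ℕ→ℚ m + ℕ→ℚ n
ℕ→ℚ-homo-+ m n = toℚᵘ-injective (ℚᵘ.≃-trans (ℕ→ℚ≃ (m ℕ.+ n)) (ℚᵘ.≃-trans
  (ℚᵘ.*≡* (solve 2 (λ x y → (x :+ y) :* con (ℤ.+ 1) := (x :* con (ℤ.+ 1) :+ y :* con (ℤ.+ 1)) :* con (ℤ.+ 1)) refl (ℤ.+ m) (ℤ.+ n)))
  (ℚᵘ.≃-sym (ℚᵘ.≃-trans (toℚᵘ-homo-+ (ℕ→ℚ m) (ℕ→ℚ n)) (ℚᵘ.+-cong (ℕ→ℚ≃ m) (ℕ→ℚ≃ n))))))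
  where open ℤ-Solver.+-*-Solver

ℕ→ℚ-mono-≤ : ∀ {m n} → m ℕ.≤ n → ℕ→ℚ m ≤ ℕ→ℚ n
ℕ→ℚ-mono-≤ {m} {n} m≤n = toℚᵘ-cancel-≤ (ℚᵘ.≤-respʳ-≃ (ℚᵘ.≃-sym (ℕ→ℚ≃ n)) (ℚᵘ.≤-respˡ-≃ (ℚᵘ.≃-sym (ℕ→ℚ≃ m))
  (ℚᵘ.*≤* (ℤ.*-monoʳ-≤-nonNeg (ℤ.+ 1) (ℤ.+≤+ m≤n)))))

ℕ→ℚ-nonNeg : ∀ m → NonNegative (ℕ→ℚ m)
ℕ→ℚ-nonNeg m = normalize-nonNeg m 1

e/m*m≡e : ∀ e m → (ℤ.+ e / suc m) * ℕ→ℚ (suc m) ≡ ℕ→ℚ e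
e/m*m≡e e m = toℚᵘ-injective (ℚᵘ.≃-trans (toℚᵘ-homo-* (ℤ.+ e / suc m) (ℕ→ℚ (suc m)))
  (ℚᵘ.≃-trans (ℚᵘ.*-cong (toℚᵘ-fromℚᵘ (ℚᵘ.mkℚᵘ (ℤ.+ e) m)) (ℕ→ℚ≃ (suc m)))
  (ℚᵘ.≃-trans (ℚᵘ.*≡* (solve 2 (λ x y → (x :* y) :* con (ℤ.+ 1) := x :* (y :* con (ℤ.+ 1))) refl (ℤ.+ e) (ℤ.+ suc m)))
  (ℚᵘ.≃-sym (ℕ→ℚ≃ e)))))
  where open ℤ-Solver.+-*-Solver

∑-⇂-lower-bound : ∀ {n} (p : Subset n) (f : Fin n → ℕ) {c} K .{{_ : NonNegative K}} →
                  (∀ {u} → u ∈ p → c ≤ K * ℕ→ℚ (f u)) → ℕ→ℚ ∣ p ∣ * c ≤ K * ℕ→ℚ (sum (f ⇂ p))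
∑-⇂-lower-bound []          f {c} K c≤Kf = ≤-reflexive (trans (*-zeroˡ c) (≡.sym (*-zeroʳ K)))
∑-⇂-lower-bound (false ∷ p) f     K c≤Kf = ∑-⇂-lower-bound p (f ∘ suc) K (c≤Kf ∘ there)
∑-⇂-lower-bound (true ∷ p)  f {c} K c≤Kf = begin
  ℕ→ℚ (suc ∣ p ∣) * c                     ≡⟨ cong (_* c) (ℕ→ℚ-homo-+ 1 ∣ p ∣) ⟩
  (1ℚ + ℕ→ℚ ∣ p ∣) * c                    ≡⟨ trans (*-distribʳ-+ c 1ℚ (ℕ→ℚ ∣ p ∣)) (cong (_+ ℕ→ℚ ∣ p ∣ * c) (*-identityˡ c)) ⟩
  c + ℕ→ℚ ∣ p ∣ * c                       ≤⟨ +-mono-≤ (c≤Kf here) (∑-⇂-lower-bound p (f ∘ suc) K (c≤Kf ∘ there)) ⟩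
  K * ℕ→ℚ (f zero) + K * ℕ→ℚ (sum rest)  ≡⟨ ≡.sym (*-distribˡ-+ K _ _) ⟩
  K * (ℕ→ℚ (f zero) + ℕ→ℚ (sum rest))    ≡⟨ cong (K *_) (≡.sym (ℕ→ℚ-homo-+ (f zero) (sum rest))) ⟩
  K * ℕ→ℚ (f zero ℕ.+ sum rest)           ∎
  where
  open ≤-Reasoning
  rest : Fin _ → ℕ
  rest = (f ∘ suc) ⇂ p

1/-unique : ∀ p q .{{_ : NonZero p}} → p * q ≡ 1ℚ → 1/ p ≡ q
1/-unique p q pq≡1 = begin
  1/ p              ≡⟨ ≡.sym (*-identityʳ (1/ p)) ⟩
  1/ p * 1ℚ         ≡⟨ cong (1/ p *_) (≡.sym pq≡1) ⟩
  1/ p * (p * q)    ≡⟨ ≡.sym (*-assoc (1/ p) p q) ⟩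
  1/ p * p * q      ≡⟨ cong (_* q) (*-inverseˡ p) ⟩
  1ℚ * q            ≡⟨ *-identityˡ q ⟩
  q                 ∎
  where open ≡-Reasoning

1/K*x≤y⇒x≤K*y : ∀ K .{{_ : Positive K}} {x y} → (1/ K) {{pos⇒nonZero K}} * x ≤ y → x ≤ K * y
1/K*x≤y⇒x≤K*y K {x} {y} x/K≤y = begin
  x                    ≡⟨ ≡.sym (*-identityˡ x) ⟩
  1ℚ * x               ≡⟨ cong (_* x) (≡.sym (*-inverseʳ K)) ⟩
  K * 1/ K * x         ≡⟨ *-assoc K (1/ K) x ⟩
  K * (1/ K * x)       ≤⟨ *-monoˡ-≤-nonNeg K x/K≤y ⟩
  K * y                ∎
  where
  open ≤-Reasoning
  instance
    K≢0 : NonZero K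
    K≢0 = pos⇒nonZero K
    K≥0 : NonNegative K
    K≥0 = pos⇒nonNeg K

+-cancelʳ-≤ : ∀ r {p q} → p + r ≤ q + r → p ≤ q
+-cancelʳ-≤ r {p} {q} p+r≤q+r = subst₂ _≤_ (cancel p) (cancel q) (+-monoˡ-≤ (- r) p+r≤q+r)
  where
  open +-*-Solver
  cancel : ∀ x → x + r - r ≡ x
  cancel x = solve 2 (λ x r → x :+ r :- r := x) refl x r

x≤K*x : ∀ {K x} → 1ℚ ≤ K → 0ℚ ≤ x → x ≤ K * x
x≤K*x {K} {x} 1≤K 0≤x = begin
  x        ≡⟨ ≡.sym (*-identityˡ x) ⟩
  1ℚ * x   ≤⟨ *-monoʳ-≤-nonNeg x {{nonNegative 0≤x}} 1≤K ⟩
  K * x    ∎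
  where open ≤-Reasoning

sw≤K[s+K[s+w]]⇒s≤2K² : ∀ {K s w} → 1ℚ ≤ K → 0ℚ ≤ s → ℕ→ℚ 4 * (K * (K * K)) ≤ w →
                        s * w ≤ K * (s + K * (s + w)) → s ≤ ℕ→ℚ 2 * (K * K)
sw≤K[s+K[s+w]]⇒s≤2K² {K} {s} {w} 1≤K 0≤s 4K³≤w sw≤ =
  *-cancelʳ-≤-pos w {{w>0}} (+-cancelʳ-≤ (s * (two * K + two * (K * K))) (begin
    s * w + s * (two * K + two * (K * K))   ≤⟨ +-monoʳ-≤ (s * w) (*-monoˡ-≤-nonNeg s {{nonNegative 0≤s}} 2K+2K²≤w) ⟩
    s * w + s * w                           ≡⟨ solve 2 (λ s w → s :* w :+ s :* w := con two :* (s :* w)) refl s w ⟩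
    two * (s * w)                           ≤⟨ *-monoˡ-≤-nonNeg two sw≤ ⟩
    two * (K * (s + K * (s + w)))           ≡⟨ solve 3 (λ k s w → con two :* (k :* (s :+ k :* (s :+ w)))
                                                := (con two :* (k :* k)) :* w :+ s :* (con two :* k :+ con two :* (k :* k))) refl K s w ⟩
    two * (K * K) * w + s * (two * K + two * (K * K)) ∎))
  where
  open ≤-Reasoning
  open +-*-Solver
  two : ℚ
  two = ℕ→ℚ 2
  0≤K : 0ℚ ≤ K
  0≤K = ≤-trans (nonNegative⁻¹ 1ℚ) 1≤K
  K≤K² : K ≤ K * K
  K≤K² = x≤K*x 1≤K 0≤K
  K²≤K³ : K * K ≤ K * (K * K)
  K²≤K³ = x≤K*x 1≤K (≤-trans 0≤K K≤K²)
  2K+2K²≤w : two * K + two * (K * K) ≤ w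
  2K+2K²≤w = begin
    two * K + two * (K * K)                    ≤⟨ +-mono-≤ (*-monoˡ-≤-nonNeg two (≤-trans K≤K² K²≤K³)) (*-monoˡ-≤-nonNeg two K²≤K³) ⟩
    two * (K * (K * K)) + two * (K * (K * K))  ≡⟨ solve 1 (λ x → con two :* x :+ con two :* x := con (ℕ→ℚ 4) :* x) refl (K * (K * K)) ⟩
    ℕ→ℚ 4 * (K * (K * K))                      ≤⟨ 4K³≤w ⟩
    w                                          ∎
  instance
    K>0 : Positive K
    K>0 = positive (<-≤-trans (positive⁻¹ 1ℚ) 1≤K)
    K²>0 : Positive (K * K)
    K²>0 = pos*pos⇒pos K K
    K³>0 : Positive (K * (K * K))
    K³>0 = pos*pos⇒pos K (K * K)
  w>0 : Positive w
  w>0 = positive (<-≤-trans (positive⁻¹ (ℕ→ℚ 4 * (K * (K * K))) {{pos*pos⇒pos (ℕ→ℚ 4) (K * (K * K))}}) 4K³≤w)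

module _ (∇₁ : ℚ) (pos : 0ℚ < ∇₁) where

  private
    K α : ℚ
    K = kOf ∇₁
    α = αOf ∇₁ pos
    instance
      ∇₁>0 : Positive ∇₁
      ∇₁>0 = positive pos
      K>0 : Positive K
      K>0 = pos+pos⇒pos ∇₁ ∇₁
      K≢0 : NonZero K
      K≢0 = pos⇒nonZero K
      α>0 : Positive α
      α>0 = αOf-pos ∇₁ pos
      α²≢0 : NonZero (α * α)
      α²≢0 = pos⇒nonZero (α * α) {{pos*pos⇒pos α α}}

  open +-*-Solver

  threshold≡4K³ : threshold ∇₁ pos ≡ ℕ→ℚ 4 * (K * (K * K))
  threshold≡4K³ = trans (cong (ℕ→ℚ 8 * ∇₁ *_) (1/-unique (α * α) (K * K) α²K²≡1))
    (solve 1 (λ x → con (ℕ→ℚ 8) :* x :* ((x :+ x) :* (x :+ x)) := con (ℕ→ℚ 4) :* ((x :+ x) :* ((x :+ x) :* (x :+ x)))) refl ∇₁)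
    where
    α²K²≡1 : α * α * (K * K) ≡ 1ℚ
    α²K²≡1 = trans (solve 2 (λ a k → (a :* a) :* (k :* k) := (a :* k) :* (a :* k)) refl α K)
                   (cong₂ _*_ (*-inverseˡ K) (*-inverseˡ K))

  bound≡2K² : bound ∇₁ pos ≡ ℕ→ℚ 2 * (K * K)
  bound≡2K² = trans (cong (ℕ→ℚ 4 * ∇₁ *_) (1/-involutive K))
    (solve 1 (λ x → con (ℕ→ℚ 4) :* x :* (x :+ x) := con (ℕ→ℚ 2) :* ((x :+ x) :* (x :+ x))) refl ∇₁)

module _ {n} (G : Graph n) {∇₁ : ℚ} (isN : IsNabla1 G ∇₁) where

  edges≤∇₁*size : ∀ {m} (M : ShallowMinor1 G m) → ℕ→ℚ (edges M) ≤ ∇₁ * ℕ→ℚ m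
  edges≤∇₁*size {zero}  M = ≤-reflexive (≡.sym (*-zeroʳ ∇₁))
  edges≤∇₁*size {suc m} M = subst (_≤ ∇₁ * ℕ→ℚ (suc m)) (e/m*m≡e (edges M) m)
    (*-monoʳ-≤-nonNeg (ℕ→ℚ (suc m)) {{ℕ→ℚ-nonNeg (suc m)}} (proj₁ isN m M))

  edge⇒1≤k : ∀ {b b′} → adj G b b′ ≡ true → 1ℚ ≤ kOf ∇₁
  edge⇒1≤k bb′ = begin
    1ℚ               ≡⟨ cong ℕ→ℚ (≡.sym edges≡1) ⟩
    ℕ→ℚ (edges M)    ≤⟨ edges≤∇₁*size M ⟩
    ∇₁ * ℕ→ℚ 2       ≡⟨ cong (∇₁ *_) (ℕ→ℚ-homo-+ 1 1) ⟩
    ∇₁ * (1ℚ + 1ℚ)   ≡⟨ solve 1 (λ x → x :* (con 1ℚ :+ con 1ℚ) := x :+ x) refl ∇₁ ⟩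
    ∇₁ + ∇₁          ∎
    where
    open ≤-Reasoning
    open +-*-Solver
    M : ShallowMinor1 G 2
    M = proj₁ (edge⇒2-vertex-minor G bb′)
    edges≡1 : edges M ≡ 1
    edges≡1 = proj₂ (edge⇒2-vertex-minor G bb′)

  edges≡0⇒∇₁≡0 : ∀ {m} (M : ShallowMinor1 G (suc m)) → ℤ.+ edges M / suc m ≡ ∇₁ → edges M ≡ 0 → ∇₁ ≡ 0ℚ
  edges≡0⇒∇₁≡0 {m} M ratio≡∇₁ edges≡0 =
    trans (≡.sym ratio≡∇₁) (trans (cong (λ e → ℤ.+ e / suc m) edges≡0) (0/n≡0 (suc m)))

  edgeless⇒∇₁≡0 : (∀ b b′ → adj G b b′ ≡ false) → ∇₁ ≡ 0ℚ
  edgeless⇒∇₁≡0 edgeless with _ , M , ratio≡∇₁ ← proj₂ isN = edges≡0⇒∇₁≡0 M ratio≡∇₁ (edgeless⇒edges≡0 G edgeless M)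

  1≤k : 0ℚ < ∇₁ → 1ℚ ≤ kOf ∇₁
  1≤k 0<∇₁ = by-cases (edge? G)
    where
    by-cases : Dec (∃₂ λ b b′ → adj G b b′ ≡ true) → 1ℚ ≤ kOf ∇₁
    by-cases (yes (_ , _ , bb′)) = edge⇒1≤k bb′
    by-cases (no no-edge)        = ⊥-elim (<-irrefl (≡.sym (edgeless⇒∇₁≡0 edgeless)) 0<∇₁)
      where
      edgeless : ∀ b b′ → adj G b b′ ≡ false
      edgeless b b′ = ¬-not (λ bb′ → no-edge (b , b′ , bb′))

  module _ (pos : 0ℚ < ∇₁) where

    private
      K : ℚ
      K = kOf ∇₁
      instance
        ∇₁≥0 : NonNegative ∇₁
        ∇₁≥0 = pos⇒nonNeg ∇₁ {{positive pos}}
        K>0 : Positive K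
        K>0 = pos+pos⇒pos ∇₁ {{positive pos}} ∇₁ {{positive pos}}
        K≥0 : NonNegative K
        K≥0 = pos⇒nonNeg K

    edges[S∪W]≤∇₁[∣S∣+∣W∣] : ∀ S W → ℕ→ℚ (edges (induced G (S ∪ W))) ≤ ∇₁ * (ℕ→ℚ ∣ S ∣ + ℕ→ℚ ∣ W ∣)
    edges[S∪W]≤∇₁[∣S∣+∣W∣] S W = begin
      ℕ→ℚ (edges (induced G (S ∪ W)))   ≤⟨ edges≤∇₁*size (induced G (S ∪ W)) ⟩
      ∇₁ * ℕ→ℚ ∣ S ∪ W ∣                ≤⟨ *-monoˡ-≤-nonNeg ∇₁ (ℕ→ℚ-mono-≤ (∣p∪q∣≤∣p∣+∣q∣ S W)) ⟩
      ∇₁ * ℕ→ℚ (∣ S ∣ ℕ.+ ∣ W ∣)        ≡⟨ cong (∇₁ *_) (ℕ→ℚ-homo-+ ∣ S ∣ ∣ W ∣) ⟩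
      ∇₁ * (ℕ→ℚ ∣ S ∣ + ℕ→ℚ ∣ W ∣)      ∎
      where open ≤-Reasoning

    strong-double-count : ∀ W S → (∀ z → z ∈ S → IsStrong G (αOf ∇₁ pos) W z) →
                          ℕ→ℚ ∣ S ∣ * ℕ→ℚ ∣ W ∣ ≤ K * (ℕ→ℚ ∣ S ∣ + K * (ℕ→ℚ ∣ S ∣ + ℕ→ℚ ∣ W ∣))
    strong-double-count W S strong = begin
      s * w                                    ≤⟨ ∑-⇂-lower-bound S t K (λ {z} z∈S → 1/K*x≤y⇒x≤K*y K (strong z z∈S)) ⟩
      K * ℕ→ℚ (sum (t ⇂ S))                    ≤⟨ *-monoˡ-≤-nonNeg K (ℕ→ℚ-mono-≤ (∑∣N[z]∩W∣≤∣S∣+2e G S W)) ⟩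
      K * ℕ→ℚ (∣ S ∣ ℕ.+ (e ℕ.+ e))            ≡⟨ cong (K *_) (trans (ℕ→ℚ-homo-+ ∣ S ∣ (e ℕ.+ e)) (cong (s +_) (ℕ→ℚ-homo-+ e e))) ⟩
      K * (s + (ℕ→ℚ e + ℕ→ℚ e))                ≤⟨ *-monoˡ-≤-nonNeg K (+-monoʳ-≤ s (+-mono-≤ e≤ e≤)) ⟩
      K * (s + (∇₁ * (s + w) + ∇₁ * (s + w)))  ≡⟨ cong (λ x → K * (s + x)) (≡.sym (*-distribʳ-+ (s + w) ∇₁ ∇₁)) ⟩
      K * (s + K * (s + w))                    ∎
      where
      open ≤-Reasoning
      s w : ℚ
      s = ℕ→ℚ ∣ S ∣
      w = ℕ→ℚ ∣ W ∣
      t : Fin n → ℕ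
      t z = ∣ N[ G ] z ∩ W ∣
      e : ℕ
      e = edges (induced G (S ∪ W))
      e≤ : ℕ→ℚ e ≤ ∇₁ * (s + w)
      e≤ = edges[S∪W]≤∇₁[∣S∣+∣W∣] S W

lemma4 : ∀ {n : ℕ} (G : Graph n) (∇₁ : ℚ) → IsNabla1 G ∇₁ → (pos : 0ℚ < ∇₁)
         → StandingAssumption G (kOf ∇₁)
         → (W : Subset n) → threshold ∇₁ pos ≤ ℕ→ℚ ∣ W ∣
         → (S : Subset n) → (∀ z → z ∈ S → IsStrong G (αOf ∇₁ pos) W z)
         → ℕ→ℚ ∣ S ∣ ≤ bound ∇₁ pos
lemma4 G ∇₁ isN pos _ W large S strong =
  subst (ℕ→ℚ ∣ S ∣ ≤_) (≡.sym (bound≡2K² ∇₁ pos))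
    (sw≤K[s+K[s+w]]⇒s≤2K² (1≤k G isN pos) (nonNegative⁻¹ _ {{ℕ→ℚ-nonNeg ∣ S ∣}})
      (subst (_≤ ℕ→ℚ ∣ W ∣) (threshold≡4K³ ∇₁ pos) large)
      (strong-double-count G isN pos W S strong))
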